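{- Let $F\in\mathcal{F}_n$ have border vertices $V_0,\dots,V_{2n}$ and let $h_0h_1\dots h_{2n}$ be the height sequence of its border $D_F$. Then for every full rook placement $R$ on $F$ and every $0\le i\le 2n$, $$h_i=|R\cap\Gamma(V_i)|.$$
   Context: A Dyck path of semilength $n$ is a lattice path from $(0,n)$ to $(n,0)$ with unit east and south steps never going strictly below $y=n-x$. $\mathcal{F}_n$ is the set of Ferrers boards whose border (the path bounding them together with the coordinate axes) is such a Dyck path; the border vertices are $V_0=(0,n),V_1,\dots,V_{2n}=(n,0)$ in order along the path. The height sequence of a Dyck path is $d_0,\dots,d_{2n}$ with $d_0=0$, $d_{i+1}=d_i+1$ if $V_{i+1}$ is to the right of $V_i$ and $d_{i+1}=d_i-1$ if $V_{i+1}$ is below $V_i$. A full rook placement on $F$ is a set $R$ of unit squares of $F$ with exactly one square in each row and each column of $F$. For a lattice point $V=(a,b)$, $\Gamma(V)$ is the set of unit squares inside $[0,a]\times[0,b]$. -}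

module Defs where

open import Data.Nat using (ℕ; zero; suc; _+_; _∸_; _≤_; _<_)
open import Data.Integer using (ℤ; +_; -_) renaming (_+_ to _+ℤ_)
open import Data.Fin using (Fin; toℕ)
open import Data.List using (List; []; _∷_; length; take)
open import Data.Bool using (Bool; true; false)
open import Data.Product using (Σ; ∃; _×_; _,_)
open import Relation.Binary.PropositionalEquality using (_≡_)

-- A unit step of a lattice path: E = east (right), S = south (down).
data Step : Set where
  E S : Step

#E : List Step → ℕ
#E []       = 0
#E (E ∷ xs) = suc (#E xs)
#E (S ∷ xs) = #E xs

#S : List Step → ℕ
#S []       = 0
#S (E ∷ xs) = #S xs
#S (S ∷ xs) = suc (#S xs)

-- Coordinates of the border vertex V_i of a path p starting at (0,n):
-- V_i is reached after the first i steps.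
xV : List Step → ℕ → ℕ
xV p i = #E (take i p)

yV : ℕ → List Step → ℕ → ℕ
yV n p i = n ∸ #S (take i p)

-- Dyck path of semilength n: from (0,n) to (n,0) with E/S unit steps,
-- never strictly below the line y = n - x (i.e. x + y ≥ n at every vertex).
record IsDyck (n : ℕ) (p : List Step) : Set where
  field
    endE   : #E p ≡ n
    endS   : #S p ≡ n
    above  : ∀ i → i ≤ length p → n ≤ xV p i + yV n p i

heightAux : ℤ → List Step → ℤ
heightAux d []       = d
heightAux d (E ∷ xs) = heightAux (d +ℤ + 1) xs
heightAux d (S ∷ xs) = heightAux (d +ℤ - (+ 1)) xs

height : List Step → ℕ → ℤ
height p i = heightAux (+ 0) (take i p)

-- Cells: the unit square [a,a+1] × [b,b+1] with a = column, b = row,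
-- 0 ≤ a, b < n.  The Ferrers board F bounded by the path p and the
-- coordinate axes: a cell lies in F iff its upper-right corner (a+1,b+1)
-- is weakly below-left of some border vertex.
InBoard : (n : ℕ) → List Step → Fin n → Fin n → Set
InBoard n p a b = ∃ λ i → i ≤ length p × (toℕ a < xV p i × toℕ b < yV n p i)

-- A full rook placement on F (rows and columns of F are the n rows and
-- n columns of the n × n square): a set R of cells of F, given by its
-- characteristic function, with exactly one cell in each row and column.
record FullRook (n : ℕ) (p : List Step) (R : Fin n → Fin n → Bool) : Set where
  field
    inBoard : ∀ a b → R a b ≡ true → InBoard n p a b
    row     : ∀ b → ∃ λ a → R a b ≡ true × (∀ a' → R a' b ≡ true → a' ≡ a)
    col     : ∀ a → ∃ λ b → R a b ≡ true × (∀ b' → R a b' ≡ true → b' ≡ b)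

sumFin : ∀ {n} → (Fin n → ℕ) → ℕ
sumFin {zero}  f = 0
sumFin {suc n} f = f Fin.zero + sumFin (λ k → f (Fin.suc k))

open import Relation.Nullary.Decidable using (⌊_⌋)
open import Data.Nat using (_<?_)
open import Data.Bool using (_∧_)

ind : Bool → ℕ
ind true  = 1
ind false = 0

-- |R ∩ Γ(V)| for V = (x,y): Γ(V) = unit squares inside [0,x] × [0,y].
cardRΓ : ∀ {n} → (Fin n → Fin n → Bool) → ℕ → ℕ → ℕ
cardRΓ R x y = sumFin λ a → sumFin λ b →
  ind (R a b ∧ ⌊ toℕ a <? x ⌋ ∧ ⌊ toℕ b <? y ⌋)

-- Every rook in a column left of V_i lies either in Γ(V_i) or in a row above V_i, and
-- conversely every rook in a row above V_i lies left of V_i (the part of F above the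
-- horizontal line through V_i was already traversed by the border). Counting by columns
-- and by rows, x_i = |R ∩ Γ(V_i)| + (n - y_i), and n - y_i is the number of south steps
-- among the first i, so |R ∩ Γ(V_i)| = #E - #S = h_i.
module Submission where

open import Defs
open import Data.Nat using (ℕ; _≤_; _*_)
open import Data.Integer using (+_)
open import Data.Fin using (Fin)
open import Data.List using (List)
open import Data.Bool using (Bool)
open import Relation.Binary.PropositionalEquality using (_≡_)

open import Data.Nat using (zero; suc; _+_; _∸_; _<_; z≤n; s≤s; s<s⁻¹; _<?_)
open import Data.Nat.Properties
  using (≤-trans; ≤-reflexive; ≤-total; <-≤-trans; ∸-monoʳ-≤; m≤n+m; m+n∸n≡m; m∸[m∸n]≡n; +-0-commutativeMonoid)
open import Data.Integer using (_⊖_; -[1+_]) renaming (_+_ to _+ℤ_)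
open import Data.Integer.Properties using (+-identityˡ; +-identityʳ; +-assoc; distribʳ-⊖-+-pos; distribʳ-⊖-+-neg; ⊖-≥)
open import Data.Fin using (toℕ) renaming (zero to fzero; suc to fsuc)
open import Data.Fin.Properties using (suc-injective; 0≢1+n)
open import Data.List using ([]; _∷_; take)
open import Data.Bool using (true; false; _∧_; not)
open import Data.Bool.Properties using (∧-identityʳ; ∧-zeroʳ; ¬-not)
open import Data.Product using (∃; _×_; _,_)
open import Data.Sum using (inj₁; inj₂)
open import Function using (_∘_)
open import Relation.Nullary using (yes; no; ¬_; contradiction)
open import Relation.Nullary.Decidable using (⌊_⌋)
open import Relation.Binary.PropositionalEquality using (refl; sym; trans; cong; cong₂; module ≡-Reasoning)
open import Algebra.Properties.CommutativeMonoid.Sum +-0-commutativeMonoid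
  using (sum; sum-syntax; sum-cong-≗; ∑-distrib-+; ∑-comm)

sumFin≡sum : ∀ {m} (f : Fin m → ℕ) → sumFin f ≡ sum f
sumFin≡sum {zero}  f = refl
sumFin≡sum {suc m} f = cong (λ t → f fzero + t) (sumFin≡sum (f ∘ fsuc))

UniqueTrue : ∀ {m} → (Fin m → Bool) → Set
UniqueTrue f = ∃ λ k → f k ≡ true × (∀ k′ → f k′ ≡ true → k′ ≡ k)

∑-ind-false : ∀ {m} (f : Fin m → Bool) → (∀ k → f k ≡ false) → ∑[ k < m ] ind (f k) ≡ 0
∑-ind-false {zero}  f all-false = refl
∑-ind-false {suc m} f all-false
  rewrite all-false fzero = ∑-ind-false (f ∘ fsuc) (all-false ∘ fsuc)

∑-ind-unique : ∀ {m} (f : Fin m → Bool) → UniqueTrue f → ∑[ k < m ] ind (f k) ≡ 1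
∑-ind-unique f (fzero , fk , unique) rewrite fk =
  cong suc (∑-ind-false (f ∘ fsuc) λ j → ¬-not (0≢1+n ∘ sym ∘ unique (fsuc j)))
∑-ind-unique f (fsuc k , fk , unique) with f fzero in f0
... | true  = contradiction (unique fzero f0) 0≢1+n
... | false = ∑-ind-unique (f ∘ fsuc) (k , fk , λ k′ e → suc-injective (unique (fsuc k′) e))

∑-ind-∧-unique : ∀ {m} (f : Fin m → Bool) → UniqueTrue f → (c : Bool) → ∑[ k < m ] ind (f k ∧ c) ≡ ind c
∑-ind-∧-unique {m} f u true  = trans (sum-cong-≗ {m} (cong ind ∘ ∧-identityʳ ∘ f)) (∑-ind-unique f u)
∑-ind-∧-unique f u false = ∑-ind-false (λ k → f k ∧ false) (∧-zeroʳ ∘ f)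

<?-suc : ∀ a x → ⌊ suc a <? suc x ⌋ ≡ ⌊ a <? x ⌋
<?-suc a x with suc a <? suc x | a <? x
... | yes _       | yes _   = refl
... | no _        | no _    = refl
... | yes 1+a<1+x | no a≮x  = contradiction (s<s⁻¹ 1+a<1+x) a≮x
... | no 1+a≮1+x  | yes a<x = contradiction (s≤s a<x) 1+a≮1+x

∑-ind-< : ∀ {m x} → x ≤ m → ∑[ a < m ] ind ⌊ toℕ a <? x ⌋ ≡ x
∑-ind-< {zero}  z≤n       = refl
∑-ind-< {suc m} {zero} _  = ∑-ind-false {suc m} (λ a → ⌊ toℕ a <? 0 ⌋) λ _ → refl
∑-ind-< {suc m} {suc x} (s≤s x≤m) =
  cong suc (trans (sum-cong-≗ {m} λ a → cong ind (<?-suc (toℕ a) x)) (∑-ind-< x≤m))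

∑-ind-≮ : ∀ m x → ∑[ a < m ] ind (not ⌊ toℕ a <? x ⌋) ≡ m ∸ x
∑-ind-≮ zero    zero    = refl
∑-ind-≮ zero    (suc x) = refl
∑-ind-≮ (suc m) zero    = cong suc (∑-ind-≮ m zero)
∑-ind-≮ (suc m) (suc x) =
  trans (sum-cong-≗ {m} λ a → cong (ind ∘ not) (<?-suc (toℕ a) x)) (∑-ind-≮ m x)

ind-∧-split : ∀ r c d → ind (r ∧ c) ≡ ind (r ∧ c ∧ d) + ind (r ∧ c ∧ not d)
ind-∧-split true  true  true  = refl
ind-∧-split true  true  false = refl
ind-∧-split true  false _     = refl
ind-∧-split false _     _     = refl

module RookCount {m n : ℕ} (R : Fin m → Fin n → Bool) where

  count : (Fin m → Fin n → Bool) → ℕ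
  count P = ∑[ a < m ] ∑[ b < n ] ind (R a b ∧ P a b)

  Γ : ℕ → ℕ → Fin m → Fin n → Bool
  Γ x y a b = ⌊ toℕ a <? x ⌋ ∧ ⌊ toℕ b <? y ⌋

  count-split : (P Q : Fin m → Fin n → Bool) →
                count P ≡ count (λ a b → P a b ∧ Q a b) + count (λ a b → P a b ∧ not (Q a b))
  count-split P Q = trans (sum-cong-≗ {m} count-column-split)
    (∑-distrib-+ (λ a → ∑[ b < n ] ind (R a b ∧ P a b ∧ Q a b)) (λ a → ∑[ b < n ] ind (R a b ∧ P a b ∧ not (Q a b))))
    where
    count-column-split : ∀ a → ∑[ b < n ] ind (R a b ∧ P a b) ≡
      ∑[ b < n ] ind (R a b ∧ P a b ∧ Q a b) + ∑[ b < n ] ind (R a b ∧ P a b ∧ not (Q a b))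
    count-column-split a = trans (sum-cong-≗ {n} λ b → ind-∧-split (R a b) (P a b) (Q a b))
                             (∑-distrib-+ (λ b → ind (R a b ∧ P a b ∧ Q a b)) (λ b → ind (R a b ∧ P a b ∧ not (Q a b))))

  count-cong : {P Q : Fin m → Fin n → Bool} → (∀ a b → R a b ≡ true → P a b ≡ Q a b) → count P ≡ count Q
  count-cong {P} {Q} P≡Q = sum-cong-≗ {m} λ a → sum-cong-≗ {n} λ b → on-cell a b
    where
    on-cell : ∀ a b → ind (R a b ∧ P a b) ≡ ind (R a b ∧ Q a b)
    on-cell a b with R a b in e
    ... | true  = cong ind (P≡Q a b e)
    ... | false = refl

  count-columns : (∀ a → UniqueTrue (R a)) → (c : Fin m → Bool) → count (λ a _ → c a) ≡ ∑[ a < m ] ind (c a)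
  count-columns col c = sum-cong-≗ {m} λ a → ∑-ind-∧-unique (R a) (col a) (c a)

  count-rows : (∀ b → UniqueTrue (λ a → R a b)) → (r : Fin n → Bool) → count (λ _ b → r b) ≡ ∑[ b < n ] ind (r b)
  count-rows row r = trans (∑-comm (λ a b → ind (R a b ∧ r b)))
    (sum-cong-≗ {n} λ b → ∑-ind-∧-unique (λ a → R a b) (row b) (r b))

  count-Γ : ∀ {x y} → x ≤ m →
            (∀ a → UniqueTrue (R a)) → (∀ b → UniqueTrue (λ a → R a b)) →
            (∀ a b → R a b ≡ true → ¬ toℕ b < y → toℕ a < x) →
            count (Γ x y) + (n ∸ y) ≡ x
  count-Γ {x} {y} x≤m col row rows-above-lie-left = sym (begin
    x                                                                ≡⟨ sym (∑-ind-< x≤m) ⟩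
    ∑[ a < m ] ind (left a)                                          ≡⟨ sym (count-columns col left) ⟩
    count (λ a _ → left a)                                           ≡⟨ count-split (λ a _ → left a) (λ _ → below) ⟩
    count (Γ x y) + count (λ a b → left a ∧ not (below b))          ≡⟨ cong (λ t → count (Γ x y) + t) (count-cong {λ a b → left a ∧ not (below b)} above-is-left) ⟩
    count (Γ x y) + count (λ _ b → not (below b))                   ≡⟨ cong (λ t → count (Γ x y) + t) (count-rows row (λ b → not (below b))) ⟩
    count (Γ x y) + ∑[ b < n ] ind (not (below b))                  ≡⟨ cong (λ t → count (Γ x y) + t) (∑-ind-≮ n y) ⟩
    count (Γ x y) + (n ∸ y)                                          ∎)
    where
    open ≡-Reasoning
    left : Fin m → Bool
    left a = ⌊ toℕ a <? x ⌋
    below : Fin n → Bool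
    below b = ⌊ toℕ b <? y ⌋
    above-is-left : ∀ a b → R a b ≡ true → left a ∧ not (below b) ≡ not (below b)
    above-is-left a b e with toℕ b <? y | toℕ a <? x
    ... | yes _   | _       = ∧-zeroʳ _
    ... | no _    | yes _   = refl
    ... | no b≮y  | no a≮x  = contradiction (rows-above-lie-left a b e b≮y) a≮x

cardRΓ≡count-Γ : ∀ {n} (R : Fin n → Fin n → Bool) x y → cardRΓ R x y ≡ RookCount.count R (RookCount.Γ R x y)
cardRΓ≡count-Γ {n} R x y = trans (sumFin≡sum {n} _) (sum-cong-≗ {n} λ a → sumFin≡sum {n} _)

#E-take-mono : ∀ (p : List Step) {j i} → j ≤ i → #E (take j p) ≤ #E (take i p)
#E-take-mono _       {zero}  _ = z≤n
#E-take-mono []      {suc j} _ = z≤n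
#E-take-mono (E ∷ p) (s≤s j≤i) = s≤s (#E-take-mono p j≤i)
#E-take-mono (S ∷ p) (s≤s j≤i) = #E-take-mono p j≤i

#S-take-mono : ∀ (p : List Step) {j i} → j ≤ i → #S (take j p) ≤ #S (take i p)
#S-take-mono _       {zero}  _ = z≤n
#S-take-mono []      {suc j} _ = z≤n
#S-take-mono (E ∷ p) (s≤s j≤i) = #S-take-mono p j≤i
#S-take-mono (S ∷ p) (s≤s j≤i) = s≤s (#S-take-mono p j≤i)

#E-take-≤ : ∀ (p : List Step) i → #E (take i p) ≤ #E p
#E-take-≤ _       zero    = z≤n
#E-take-≤ []      (suc i) = z≤n
#E-take-≤ (E ∷ p) (suc i) = s≤s (#E-take-≤ p i)
#E-take-≤ (S ∷ p) (suc i) = #E-take-≤ p i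

#S-take-≤ : ∀ (p : List Step) i → #S (take i p) ≤ #S p
#S-take-≤ _       zero    = z≤n
#S-take-≤ []      (suc i) = z≤n
#S-take-≤ (E ∷ p) (suc i) = #S-take-≤ p i
#S-take-≤ (S ∷ p) (suc i) = s≤s (#S-take-≤ p i)

inBoard-≮yV⇒<xV : ∀ {n p a b} i → InBoard n p a b → ¬ toℕ b < yV n p i → toℕ a < xV p i
inBoard-≮yV⇒<xV {n} {p} i (j , _ , a<xⱼ , b<yⱼ) b≮yᵢ with ≤-total i j
... | inj₁ i≤j = contradiction (<-≤-trans b<yⱼ (∸-monoʳ-≤ n (#S-take-mono p i≤j))) b≮yᵢ
... | inj₂ j≤i = <-≤-trans a<xⱼ (#E-take-mono p j≤i)

heightAux≡ : ∀ d xs → heightAux d xs ≡ d +ℤ (#E xs ⊖ #S xs)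
heightAux≡ d []       = sym (+-identityʳ d)
heightAux≡ d (E ∷ xs) = begin
  heightAux (d +ℤ + 1) xs            ≡⟨ heightAux≡ (d +ℤ + 1) xs ⟩
  d +ℤ + 1 +ℤ (#E xs ⊖ #S xs)        ≡⟨ +-assoc d (+ 1) _ ⟩
  d +ℤ (+ 1 +ℤ (#E xs ⊖ #S xs))      ≡⟨ cong (d +ℤ_) (distribʳ-⊖-+-pos 1 (#E xs) (#S xs)) ⟩
  d +ℤ (suc (#E xs) ⊖ #S xs)         ∎
  where open ≡-Reasoning
heightAux≡ d (S ∷ xs) = begin
  heightAux (d +ℤ -[1+ 0 ]) xs       ≡⟨ heightAux≡ (d +ℤ -[1+ 0 ]) xs ⟩
  d +ℤ -[1+ 0 ] +ℤ (#E xs ⊖ #S xs)   ≡⟨ +-assoc d -[1+ 0 ] _ ⟩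
  d +ℤ (-[1+ 0 ] +ℤ (#E xs ⊖ #S xs)) ≡⟨ cong (d +ℤ_) (distribʳ-⊖-+-neg 0 (#E xs) (#S xs)) ⟩
  d +ℤ (#E xs ⊖ suc (#S xs))         ∎
  where open ≡-Reasoning

height≡#E⊖#S : ∀ p i → height p i ≡ #E (take i p) ⊖ #S (take i p)
height≡#E⊖#S p i = trans (heightAux≡ (+ 0) (take i p)) (+-identityˡ _)

lemma3p2 : (n : ℕ) (p : List Step) → IsDyck n p →
    (R : Fin n → Fin n → Bool) → FullRook n p R →
    (i : ℕ) → i ≤ 2 * n →
    height p i ≡ + cardRΓ R (xV p i) (yV n p i)
lemma3p2 n p dyck R rook i _ = begin
  height p i         ≡⟨ height≡#E⊖#S p i ⟩
  x ⊖ s              ≡⟨ cong (_⊖ s) (sym C+s≡x) ⟩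
  (C + s) ⊖ s        ≡⟨ ⊖-≥ (m≤n+m s C) ⟩
  + (C + s ∸ s)      ≡⟨ cong +_ (m+n∸n≡m C s) ⟩
  + C                ∎
  where
  open ≡-Reasoning
  open IsDyck dyck
  open FullRook rook
  open RookCount R
  x s C : ℕ
  x = xV p i
  s = #S (take i p)
  C = cardRΓ R x (n ∸ s)
  x≤n : x ≤ n
  x≤n = ≤-trans (#E-take-≤ p i) (≤-reflexive endE)
  s≤n : s ≤ n
  s≤n = ≤-trans (#S-take-≤ p i) (≤-reflexive endS)
  C+s≡x : C + s ≡ x
  C+s≡x = begin
    C + s                                ≡⟨ cong₂ _+_ (cardRΓ≡count-Γ R x (n ∸ s)) (sym (m∸[m∸n]≡n s≤n)) ⟩
    count (Γ x (n ∸ s)) + (n ∸ (n ∸ s))  ≡⟨ count-Γ x≤n col row (λ a b e → inBoard-≮yV⇒<xV i (inBoard a b e)) ⟩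
    x                                    ∎
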